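{- For all integers $a,b\ge0$, except the two cases $a=b=0$ and $a=b=1$, the number $\phi^a+\phi^b$ is a phinary number.
   Context: Let $\phi=\frac{1+\sqrt5}{2}$ and $\psi=1/\phi$. The Fibonacci words over $\{A,B\}$ are $w_1=A$, $w_2=AB$, $w_{n+2}=w_{n+1}w_n$; the infinite Fibonacci word $c_1c_2c_3\cdots=ABAABABAAB\cdots$ is their common extension. With $v(A)=1$, $v(B)=\psi$, set $p_0=0$, $p_m=\sum_{i=1}^m v(c_i)$. The phinary numbers are the elements of $\mathbb{Z}^+_\Phi=\{p_m: m\ge1\}$. -}

module Defs where

open import Data.Nat using (ℕ; zero; suc; _∸_)
open import Data.Integer using (ℤ; +_; -_) renaming (_+_ to _+ℤ_; _*_ to _*ℤ_)
open import Data.List using (List; []; _∷_; _++_)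

data Letter : Set where
  A B : Letter

-- Fibonacci words w_1 = A, w_2 = AB, w_{n+2} = w_{n+1} w_n  (w 0 is unused)
w : ℕ → List Letter
w zero = []
w (suc zero) = A ∷ []
w (suc (suc zero)) = A ∷ B ∷ []
w (suc (suc (suc n))) = w (suc (suc n)) ++ w (suc n)

-- k-th letter (0-based) of a list, default A if out of range
nth : List Letter → ℕ → Letter
nth [] _ = A
nth (x ∷ xs) zero = x
nth (x ∷ xs) (suc k) = nth xs k

-- c i : the i-th letter (1-based, i ≥ 1) of the infinite Fibonacci word.
-- w (i + 1) has length ≥ i + 1 and is a prefix of the infinite word.
c : ℕ → Letter
c i = nth (w (suc i)) (i ∸ 1)

-- The ring ℤ[φ]: the pair (x , y) represents x + y φ, where φ² = φ + 1.
-- Since φ is irrational, equality of represented reals is equality of pairs.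
record Zφ : Set where
  constructor _+_φ
  field
    re : ℤ
    im : ℤ
open Zφ public

infixl 6 _⊕_
infixl 7 _⊗_

_⊕_ : Zφ → Zφ → Zφ
(a + b φ) ⊕ (c' + d φ) = (a +ℤ c') + (b +ℤ d) φ

_⊗_ : Zφ → Zφ → Zφ
(a + b φ) ⊗ (c' + d φ) = ((a *ℤ c') +ℤ (b *ℤ d)) + ((a *ℤ d) +ℤ (b *ℤ c') +ℤ (b *ℤ d)) φ

zeroφ oneφ phi psi : Zφ
zeroφ = (+ 0) + (+ 0) φ
oneφ = (+ 1) + (+ 0) φ
phi = (+ 0) + (+ 1) φ
-- ψ = 1/φ = φ - 1
psi = (- (+ 1)) + (+ 1) φ

phiPow : ℕ → Zφ
phiPow zero = oneφ
phiPow (suc n) = phi ⊗ phiPow n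

v : Letter → Zφ
v A = oneφ
v B = psi

p : ℕ → Zφ
p zero = zeroφ
p (suc m) = p m ⊕ v (c (suc m))

Phinary : Zφ → Set
Phinary x = Σ ℕ λ m → (1 ≤ m) × (p m ≡ x)
  where
  open import Data.Product using (Σ; _×_)
  open import Data.Nat using (_≤_)
  open import Relation.Binary.PropositionalEquality using (_≡_)

module Submission where

-- Give every word the weight  |x₁⋯xₖ| = v(x₁) + ⋯ + v(xₖ)  in ℤ[φ].
-- Then p m is the weight of the length-m prefix of the infinite Fibonacci word,
-- so the weight of any nonempty prefix of some w n is a phinary number.
-- Since w_{n+2} = w_{n+1} w_n and φ^{n+2} = φ^{n+1} + φ^n, induction gives
-- |w_{n+1}| = φ^n.  For b ≤ a the word w_{a+2} w_{b+1} is a prefix of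
-- w_{a+3} = w_{a+2} w_{a+1}, because the Fibonacci words form a prefix chain;
-- its weight is φ^{a+1} + φ^b.  This covers all pairs a ≠ b, and also a = b ≥ 2
-- via  φ^n + φ^{n+3} = 2 φ^{n+2}.

open import Defs
open import Data.Nat using (ℕ; zero; suc; _<_; _≤_; _≤′_; ≤′-refl; ≤′-step; _⊔_; z≤n; s≤s)
open import Data.Nat.Properties
  using (≤-refl; ≤-trans; n≤1+n; +-mono-≤; +-comm; <-cmp; m≤m⊔n; m≤n⊔m; ≤⇒≤′)
import Data.Nat as ℕ
open import Data.Integer using () renaming (_+_ to _+ℤ_)
import Data.Integer.Properties as ℤ
open import Data.List using (List; []; _∷_; _++_; length; take)
open import Data.List.Properties using (length-++; ++-assoc; ++-identityʳ; length-++-≤ˡ; take-all)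
open import Data.Product using (Σ; _×_; _,_)
open import Data.Empty using (⊥-elim)
open import Relation.Binary using (tri<; tri≈; tri>)
open import Relation.Binary.PropositionalEquality
open import Relation.Nullary using (¬_)
open ≡-Reasoning

⊕-assoc : ∀ x y z → (x ⊕ y) ⊕ z ≡ x ⊕ (y ⊕ z)
⊕-assoc (a + b φ) (c' + d φ) (e + f φ) = cong₂ _+_φ (ℤ.+-assoc a c' e) (ℤ.+-assoc b d f)

⊕-comm : ∀ x y → x ⊕ y ≡ y ⊕ x
⊕-comm (a + b φ) (c' + d φ) = cong₂ _+_φ (ℤ.+-comm a c') (ℤ.+-comm b d)

⊕-identityˡ : ∀ x → zeroφ ⊕ x ≡ x
⊕-identityˡ (a + b φ) = cong₂ _+_φ (ℤ.+-identityˡ a) (ℤ.+-identityˡ b)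

⊕-identityʳ : ∀ x → x ⊕ zeroφ ≡ x
⊕-identityʳ (a + b φ) = cong₂ _+_φ (ℤ.+-identityʳ a) (ℤ.+-identityʳ b)

-- Multiplication by φ acts as the shift  x + yφ ↦ y + (x + y)φ,  because φ² = φ + 1.
phi-⊗ : ∀ x y → phi ⊗ (x + y φ) ≡ y + (x +ℤ y) φ
phi-⊗ x y = cong₂ _+_φ
  (trans (cong₂ _+ℤ_ (ℤ.*-zeroˡ x) (ℤ.*-identityˡ y)) (ℤ.+-identityˡ y))
  (cong₂ _+ℤ_ (trans (cong₂ _+ℤ_ (ℤ.*-zeroˡ y) (ℤ.*-identityˡ x)) (ℤ.+-identityˡ x))
              (ℤ.*-identityˡ y))

phi²-⊗ : ∀ z → phi ⊗ (phi ⊗ z) ≡ (phi ⊗ z) ⊕ z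
phi²-⊗ (x + y φ) = begin
  phi ⊗ (phi ⊗ (x + y φ))   ≡⟨ cong (phi ⊗_) (phi-⊗ x y) ⟩
  phi ⊗ (y + (x +ℤ y) φ)    ≡⟨ phi-⊗ y (x +ℤ y) ⟩
  (x +ℤ y) + (y +ℤ (x +ℤ y)) φ
    ≡⟨ cong₂ _+_φ (ℤ.+-comm x y) (ℤ.+-comm y (x +ℤ y)) ⟩
  (y +ℤ x) + ((x +ℤ y) +ℤ y) φ
    ≡⟨ cong (_⊕ (x + y φ)) (sym (phi-⊗ x y)) ⟩
  (phi ⊗ (x + y φ)) ⊕ (x + y φ) ∎

phiPow-rec : ∀ n → phiPow (suc (suc n)) ≡ phiPow (suc n) ⊕ phiPow n
phiPow-rec n = phi²-⊗ (phiPow n)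

weight : List Letter → Zφ
weight [] = zeroφ
weight (x ∷ xs) = v x ⊕ weight xs

weight-++ : ∀ xs ys → weight (xs ++ ys) ≡ weight xs ⊕ weight ys
weight-++ [] ys = sym (⊕-identityˡ (weight ys))
weight-++ (x ∷ xs) ys = begin
  v x ⊕ weight (xs ++ ys)          ≡⟨ cong (v x ⊕_) (weight-++ xs ys) ⟩
  v x ⊕ (weight xs ⊕ weight ys)    ≡⟨ sym (⊕-assoc (v x) (weight xs) (weight ys)) ⟩
  (v x ⊕ weight xs) ⊕ weight ys    ∎

-- |w_{n+1}| = φ^n: both sides obey the Fibonacci recurrence with values 1, φ.
weight-w : ∀ n → weight (w (suc n)) ≡ phiPow n
weight-w zero = refl
weight-w (suc zero) = refl
weight-w (suc (suc n)) = begin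
  weight (w (suc (suc n)) ++ w (suc n))        ≡⟨ weight-++ (w (suc (suc n))) (w (suc n)) ⟩
  weight (w (suc (suc n))) ⊕ weight (w (suc n)) ≡⟨ cong₂ _⊕_ (weight-w (suc n)) (weight-w n) ⟩
  phiPow (suc n) ⊕ phiPow n                    ≡⟨ sym (phiPow-rec n) ⟩
  phiPow (suc (suc n))                         ∎

infix 4 _≼_
_≼_ : List Letter → List Letter → Set
xs ≼ ys = Σ (List Letter) λ r → ys ≡ xs ++ r

≼-refl : ∀ xs → xs ≼ xs
≼-refl xs = [] , sym (++-identityʳ xs)

≼-trans : ∀ {xs ys zs} → xs ≼ ys → ys ≼ zs → xs ≼ zs
≼-trans {xs} (r , refl) (s , refl) = r ++ s , ++-assoc xs r s

≼-++ : ∀ xs {ys zs} → ys ≼ zs → xs ++ ys ≼ xs ++ zs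
≼-++ xs {ys} (r , refl) = r , sym (++-assoc xs ys r)

nth-≼ : ∀ k {xs ys} → xs ≼ ys → k < length xs → nth ys k ≡ nth xs k
nth-≼ zero {x ∷ xs} (r , refl) _ = refl
nth-≼ (suc k) {x ∷ xs} (r , refl) (s≤s k<) = nth-≼ k {xs} (r , refl) k<

w-≼-suc : ∀ n → w n ≼ w (suc n)
w-≼-suc zero = A ∷ [] , refl
w-≼-suc (suc zero) = B ∷ [] , refl
w-≼-suc (suc (suc n)) = w (suc n) , refl

w-mono : ∀ {m n} → m ≤′ n → w m ≼ w n
w-mono {m} ≤′-refl = ≼-refl (w m)
w-mono {n = suc n} (≤′-step m≤′n) = ≼-trans (w-mono m≤′n) (w-≼-suc n)

length-w : ∀ n → n ≤ length (w n)
length-w zero = z≤n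
length-w (suc zero) = s≤s z≤n
length-w (suc (suc zero)) = s≤s (s≤s z≤n)
length-w (suc (suc (suc n))) =
  subst (suc (suc (suc n)) ≤_) (sym (length-++ (w (suc (suc n)))))
    (subst (_≤ length (w (suc (suc n))) ℕ.+ length (w (suc n))) (+-comm (suc (suc n)) 1)
      (+-mono-≤ (length-w (suc (suc n))) (≤-trans (s≤s z≤n) (length-w (suc n)))))

FibPrefix : List Letter → Set
FibPrefix L = ∀ k → k < length L → nth L k ≡ c (suc k)

-- Every prefix of a Fibonacci word is a prefix of the infinite word: the k-th
-- letter of L and of w_{k+2} (which defines c_{k+1}) are both letters of w_N
-- for N = n ⊔ (k+2).
≼-w⇒FibPrefix : ∀ {L} n → L ≼ w n → FibPrefix L
≼-w⇒FibPrefix {L} n L≼wn k k< = begin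
  nth L k               ≡⟨ sym (nth-≼ k (≼-trans L≼wn (w-mono (≤⇒≤′ (m≤m⊔n n K)))) k<) ⟩
  nth (w (n ⊔ K)) k     ≡⟨ nth-≼ k (w-mono (≤⇒≤′ (m≤n⊔m n K))) (≤-trans (n≤1+n (suc k)) (length-w K)) ⟩
  nth (w K) k           ∎
  where K = suc (suc k)

weight-take-suc : ∀ L m → m < length L → weight (take (suc m) L) ≡ weight (take m L) ⊕ v (nth L m)
weight-take-suc (x ∷ xs) zero _ = trans (⊕-identityʳ (v x)) (sym (⊕-identityˡ (v x)))
weight-take-suc (x ∷ xs) (suc m) (s≤s m<) = begin
  v x ⊕ weight (take (suc m) xs)                 ≡⟨ cong (v x ⊕_) (weight-take-suc xs m m<) ⟩
  v x ⊕ (weight (take m xs) ⊕ v (nth xs m))      ≡⟨ sym (⊕-assoc (v x) (weight (take m xs)) (v (nth xs m))) ⟩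
  (v x ⊕ weight (take m xs)) ⊕ v (nth xs m)      ∎

p-take : ∀ {L} → FibPrefix L → ∀ m → m ≤ length L → p m ≡ weight (take m L)
p-take P zero _ = refl
p-take {L} P (suc m) m< = begin
  p m ⊕ v (c (suc m))                   ≡⟨ cong₂ _⊕_ (p-take P m (≤-trans (n≤1+n m) m<)) (cong v (sym (P m m<))) ⟩
  weight (take m L) ⊕ v (nth L m)       ≡⟨ sym (weight-take-suc L m m<) ⟩
  weight (take (suc m) L)               ∎

weight-phinary : ∀ {L} n → L ≼ w n → 1 ≤ length L → Phinary (weight L)
weight-phinary {L} n L≼wn nonempty =
  length L , nonempty ,
  trans (p-take (≼-w⇒FibPrefix n L≼wn) (length L) ≤-refl) (cong weight (take-all (length L) L ≤-refl))

-- For b ≤ a, the word w_{a+2} w_{b+1} ≼ w_{a+2} w_{a+1} = w_{a+3} has weight φ^{a+1} + φ^b.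
phiPow-sum-phinary : ∀ {a b} → b ≤ a → Phinary (phiPow (suc a) ⊕ phiPow b)
phiPow-sum-phinary {a} {b} b≤a =
  subst Phinary (cong₂ _⊕_ (weight-w (suc a)) (weight-w b))
    (subst Phinary (weight-++ (w (suc (suc a))) (w (suc b)))
      (weight-phinary (suc (suc (suc a)))
        (≼-++ (w (suc (suc a))) (w-mono (≤⇒≤′ (s≤s b≤a))))
        (≤-trans (≤-trans (s≤s z≤n) (length-w (suc (suc a)))) (length-++-≤ˡ (w (suc (suc a)))))))

-- φ^{n+3} + φ^n = 2 φ^{n+2}, reducing the diagonal case to the off-diagonal one.
phiPow-double : ∀ n → phiPow (suc (suc (suc n))) ⊕ phiPow n ≡ phiPow (suc (suc n)) ⊕ phiPow (suc (suc n))
phiPow-double n = begin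
  phiPow (3 ℕ.+ n) ⊕ phiPow n                      ≡⟨ cong (_⊕ phiPow n) (phiPow-rec (suc n)) ⟩
  (phiPow (2 ℕ.+ n) ⊕ phiPow (suc n)) ⊕ phiPow n   ≡⟨ ⊕-assoc (phiPow (2 ℕ.+ n)) (phiPow (suc n)) (phiPow n) ⟩
  phiPow (2 ℕ.+ n) ⊕ (phiPow (suc n) ⊕ phiPow n)   ≡⟨ cong (phiPow (2 ℕ.+ n) ⊕_) (sym (phiPow-rec n)) ⟩
  phiPow (2 ℕ.+ n) ⊕ phiPow (2 ℕ.+ n)              ∎

mainTheorem8 : (a b : ℕ) → ¬ ((a ≡ 0) × (b ≡ 0)) → ¬ ((a ≡ 1) × (b ≡ 1))
    → Phinary (phiPow a ⊕ phiPow b)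
mainTheorem8 a b not00 not11 with <-cmp a b
... | tri< (s≤s a≤b') _ _ = subst Phinary (⊕-comm (phiPow b) (phiPow a)) (phiPow-sum-phinary a≤b')
... | tri> _ _ (s≤s b≤a') = phiPow-sum-phinary b≤a'
... | tri≈ _ refl _ with a
...   | zero = ⊥-elim (not00 (refl , refl))
...   | suc zero = ⊥-elim (not11 (refl , refl))
...   | suc (suc n) = subst Phinary (phiPow-double n) (phiPow-sum-phinary (≤-trans (n≤1+n n) (n≤1+n (suc n))))
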